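{- For each pair of coprime integers $a,c$ with $a\ge2$, $c\ge2$ there are polynomials $p_{a,c},q_{a,c}\in\mathbf{Z}[x,y]$ with the following properties. Let $g=\begin{pmatrix}a&b\\c&d\end{pmatrix}\in\mathrm{GL}_2(\mathbf{Z})$ be good. Then (1) in $R_2$ we have $g(x)=p_{a,c}+q_{a,c}z$ and $g(y)=p_{b,d}+q_{b,d}z$ (using the natural inclusion $\mathbf{Z}[x,y]\to R_2$); (2) the determinant $D:=\det\begin{pmatrix}p_{a,c}-x & q_{a,c}\\ p_{b,d}-y & q_{b,d}\end{pmatrix}\in\mathbf{Z}[x,y]$ satisfies $D=x^{a+b-1}D_0+O_x(x^{a+b-2})$, where $D_0\in\mathbf{Z}[y]$ is nonzero, monic up to a sign, and $\deg D_0=|d-c|-1\ge 0$.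
   Context: $R_2=\mathbf{Z}[x,y,z]/(x^2+y^2+z^2-xyz-4)$. A matrix $g=\begin{pmatrix}a&b\\c&d\end{pmatrix}\in\mathrm{GL}_2(\mathbf{Z})$ is good if $a,b,c,d\ge2$. For $w$ in the free group $\mathbf{F}_2=\langle X,Y\rangle$, $P_w\in\mathbf{Z}[x,y,z]$ is the unique polynomial with $\mathrm{tr}(w(A,B))=P_w(\mathrm{tr}A,\mathrm{tr}B,\mathrm{tr}AB)$ for all $A,B\in\mathrm{SL}_2(\mathbf{C})$. For $g\in\mathrm{GL}_2(\mathbf{Z})\cong\mathrm{Out}(\mathbf{F}_2)$ choose $\theta\in\mathrm{Aut}(\mathbf{F}_2)$ with $\theta(X)=w_1,\theta(Y)=w_2$ whose action on the abelianization $\mathbf{Z}^2$ (basis from $X,Y$) has matrix $g$ (first column = exponent sums of $X,Y$ in $w_1$, second column = those in $w_2$); then $g(x):=P_{w_1}$ and $g(y):=P_{w_2}$ modulo the defining ideal (equivalently, under $x\mapsto\delta+\delta^{ -1}$, $y\mapsto\eta+\eta^{ -1}$, $z\mapsto\delta\eta+\delta^{ -1}\eta^{ -1}$, $g(x)$ corresponds to $\delta^a\eta^c+\delta^{ -a}\eta^{ -c}$ and $g(y)$ to $\delta^b\eta^d+\delta^{ -b}\eta^{ -d}$). The notation $O_x(x^n)$ denotes a polynomial each of whose monomials has $x$-degree at most $n$. -}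

module Defs where

open import Data.Nat as ℕ using (ℕ; zero; suc)
open import Data.Integer as ℤ using (ℤ; +_)
open import Data.Rational as ℚ using (ℚ)
open import Data.List using (List; []; _∷_)
open import Data.Product using (_×_; _,_)
open import Data.Sum using (_⊎_)

-- Dense univariate polynomials over ℤ: coefficient lists, index = exponent.
-- Trailing zeros are allowed; all statements only look at `coeff`.

PolyZ : Set
PolyZ = List ℤ

-- Z[x,y] : polynomials in x whose coefficients are polynomials in y.
Poly2 : Set
Poly2 = List PolyZ

coeff : {A : Set} → A → List A → ℕ → A
coeff z []       _       = z
coeff z (a ∷ as) zero    = a
coeff z (a ∷ as) (suc k) = coeff z as k

module PolyOps {A : Set} (0# : A) (_⊕_ : A → A → A) (_⊗_ : A → A → A) (⊖_ : A → A) where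
  add : List A → List A → List A
  add []       q        = q
  add (a ∷ p)  []       = a ∷ p
  add (a ∷ p)  (b ∷ q)  = (a ⊕ b) ∷ add p q

  neg : List A → List A
  neg []      = []
  neg (a ∷ p) = (⊖ a) ∷ neg p

  scale : A → List A → List A
  scale c []      = []
  scale c (a ∷ p) = (c ⊗ a) ∷ scale c p

  mul : List A → List A → List A
  mul []      q = []
  mul (a ∷ p) q = add (scale a q) (0# ∷ mul p q)

  sub : List A → List A → List A
  sub p q = add p (neg q)

module PZ = PolyOps (+ 0) ℤ._+_ ℤ._*_ ℤ.-_

module P2 = PolyOps [] PZ.add PZ.mul PZ.neg

X : Poly2
X = [] ∷ ((+ 1 ∷ []) ∷ [])

Y : Poly2
Y = (+ 0 ∷ + 1 ∷ []) ∷ []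

coeff2 : Poly2 → ℕ → ℕ → ℤ
coeff2 P k j = coeff (+ 0) (coeff [] P k) j

_^ℚ_ : ℚ → ℕ → ℚ
q ^ℚ zero  = ℚ.1ℚ
q ^ℚ suc n = q ℚ.* (q ^ℚ n)

evalZ : PolyZ → ℚ → ℚ
evalZ []      t = ℚ.0ℚ
evalZ (a ∷ p) t = (a ℚ./ 1) ℚ.+ t ℚ.* evalZ p t

evalXY : Poly2 → ℚ → ℚ → ℚ
evalXY []      s t = ℚ.0ℚ
evalXY (a ∷ P) s t = evalZ a t ℚ.+ s ℚ.* evalXY P s t

-- Good matrices g = (a b ; c d) ∈ GL₂(ℤ) with a,b,c,d ≥ 2
-- (entries are ≥ 2 hence natural numbers).

Good : ℕ → ℕ → ℕ → ℕ → Set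
Good a b c d =
  (2 ℕ.≤ a × 2 ℕ.≤ b × 2 ℕ.≤ c × 2 ℕ.≤ d) ×
  ((+ a ℤ.* + d ℤ.- + b ℤ.* + c ≡ + 1) ⊎ (+ a ℤ.* + d ℤ.- + b ℤ.* + c ≡ ℤ.- + 1))
  where open import Relation.Binary.PropositionalEquality using (_≡_)

-- Equality in R₂ = Z[x,y,z]/(x²+y²+z²-xyz-4), tested through the embedding
-- R₂ ↪ Z[δ^{±1},η^{±1}], x ↦ δ+δ⁻¹, y ↦ η+η⁻¹, z ↦ δη+δ⁻¹η⁻¹.
-- `InR₂ p q m n` says: p + q·z = g-image δ^m η^n + δ^{-m} η^{-n} in R₂,
-- expressed as equality of the images at all nonzero rational δ, η
-- (a Laurent polynomial over ℤ is determined by its values on (ℚ∖0)²).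

InR₂ : Poly2 → Poly2 → ℕ → ℕ → Set
InR₂ p q m n =
  (δ η : ℚ) .{{_ : ℚ.NonZero δ}} .{{_ : ℚ.NonZero η}} →
  let δ' = ℚ.1/ δ
      η' = ℚ.1/ η
      s  = δ ℚ.+ δ'
      t  = η ℚ.+ η'
      u  = δ ℚ.* η ℚ.+ δ' ℚ.* η'
  in evalXY p s t ℚ.+ evalXY q s t ℚ.* u
       ≡ (δ ^ℚ m) ℚ.* (η ^ℚ n) ℚ.+ (δ' ^ℚ m) ℚ.* (η' ^ℚ n)
  where open import Relation.Binary.PropositionalEquality using (_≡_)

Det : Poly2 → Poly2 → Poly2 → Poly2 → Poly2
Det pac qac pbd qbd =
  P2.sub (P2.mul (P2.sub pac X) qbd) (P2.mul qac (P2.sub pbd Y))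

{-# OPTIONS --safe #-}
-- Let S k be the polynomial with S k (δ + δ⁻¹) = (δᵏ - δ⁻ᵏ) / (δ - δ⁻¹), so S 0 = 0, S 1 = 1 and
-- S (k + 2) = x S (k + 1) - S k.  Take p_{m,n} = -(S_{m+1}(x) S_{n-1}(y) + S_{m-1}(x) S_{n+1}(y)) and
-- q_{m,n} = S_m(x) S_n(y).  Writing S_{m+1}, S_{m-1} and δᵐ in terms of S_m and δ⁻ᵐ (and likewise
-- for η) turns p + q z = δᵐ ηⁿ + δ⁻ᵐ η⁻ⁿ into a ring identity.
-- As S k is monic of degree k - 1, D has x-degree at most a + b - 1, with top coefficient the
-- Casoratian S_c S_{d-1} - S_{c-1} S_d in y.  Like a Wronskian it is unchanged by
-- (c, d) ↦ (c + 1, d + 1), so it equals ±S_{|d-c|}; and c ≠ d because c would divide ad - bc = ±1.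
module Submission where

module Chebyshev where
  open import Defs
  open import Data.Nat using (ℕ; zero; suc; pred)
  open import Data.Integer using (+_)
  open import Data.List using ([]; _∷_)

  S : ℕ → PolyZ
  S zero          = []
  S (suc zero)    = + 1 ∷ []
  S (suc (suc k)) = PZ.sub (+ 0 ∷ S (suc k)) (S k)

  outer : PolyZ → PolyZ → Poly2
  outer []      v = []
  outer (a ∷ u) v = PZ.scale a v ∷ outer u v

  p-part : ℕ → ℕ → Poly2
  p-part m n = P2.neg (P2.add (outer (S (suc m)) (S (pred n))) (outer (S (pred m)) (S (suc n))))

  q-part : ℕ → ℕ → Poly2
  q-part m n = outer (S m) (S n)

  det : ℕ → ℕ → ℕ → ℕ → Poly2
  det a b c d = Det (p-part a c) (q-part a c) (p-part b d) (q-part b d)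

module Evaluation where
  open import Defs
  open Chebyshev
  open import Data.Nat using (ℕ; zero; suc; pred; _≤_; s≤s; z≤n)
  open import Data.Integer as ℤ using (ℤ; 0ℤ)
  open import Data.Rational as ℚ using (ℚ; 0ℚ; 1ℚ; _+_; _*_; _-_; -_; 1/_; toℚᵘ)
  open import Data.Rational.Properties
    using ( toℚᵘ-injective; toℚᵘ-fromℚᵘ; toℚᵘ-homo-+; toℚᵘ-homo-*; toℚᵘ-homo‿-
          ; *-comm; +-comm; *-inverseʳ; _≟_; +-*-commutativeRing)
  open import Data.Rational.Unnormalised as ℚᵘ using (mkℚᵘ; *≡*)
  import Data.Rational.Unnormalised.Properties as ℚᵘ
  open import Data.List using (List; []; _∷_)
  open import Data.Product using (_×_; _,_)
  open import Level using (0ℓ)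
  open import Relation.Nullary.Decidable using (dec⇒maybe)
  open import Relation.Binary.PropositionalEquality
  open import Tactic.RingSolver using (solve-∀)
  open import Tactic.RingSolver.Core.AlmostCommutativeRing using (AlmostCommutativeRing; fromCommutativeRing)
  import Data.Integer.Tactic.RingSolver as ℤ

  ℚ-ring : AlmostCommutativeRing 0ℓ 0ℓ
  ℚ-ring = fromCommutativeRing +-*-commutativeRing λ x → dec⇒maybe (0ℚ ≟ x)

  ι : ℤ → ℚ
  ι i = i ℚ./ 1

  toℚᵘ-ι : ∀ i → toℚᵘ (ι i) ℚᵘ.≃ mkℚᵘ i 0
  toℚᵘ-ι i = toℚᵘ-fromℚᵘ (mkℚᵘ i 0)

  ι-homo-+ : ∀ a b → ι (a ℤ.+ b) ≡ ι a + ι b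
  ι-homo-+ a b = toℚᵘ-injective (begin
    toℚᵘ (ι (a ℤ.+ b))          ≈⟨ toℚᵘ-ι (a ℤ.+ b) ⟩
    mkℚᵘ (a ℤ.+ b) 0            ≈⟨ *≡* (identity a b) ⟩
    mkℚᵘ a 0 ℚᵘ.+ mkℚᵘ b 0      ≈⟨ ℚᵘ.+-cong (toℚᵘ-ι a) (toℚᵘ-ι b) ⟨
    toℚᵘ (ι a) ℚᵘ.+ toℚᵘ (ι b)  ≈⟨ toℚᵘ-homo-+ (ι a) (ι b) ⟨
    toℚᵘ (ι a + ι b)            ∎)
    where
    open ℚᵘ.≃-Reasoning
    identity : ∀ a b → (a ℤ.+ b) ℤ.* ℤ.1ℤ ≡ (a ℤ.* ℤ.1ℤ ℤ.+ b ℤ.* ℤ.1ℤ) ℤ.* ℤ.1ℤ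
    identity = ℤ.solve-∀

  ι-homo-* : ∀ a b → ι (a ℤ.* b) ≡ ι a * ι b
  ι-homo-* a b = toℚᵘ-injective (begin
    toℚᵘ (ι (a ℤ.* b))          ≈⟨ toℚᵘ-ι (a ℤ.* b) ⟩
    mkℚᵘ (a ℤ.* b) 0            ≈⟨ ℚᵘ.*-cong (toℚᵘ-ι a) (toℚᵘ-ι b) ⟨
    toℚᵘ (ι a) ℚᵘ.* toℚᵘ (ι b)  ≈⟨ toℚᵘ-homo-* (ι a) (ι b) ⟨
    toℚᵘ (ι a * ι b)            ∎)
    where open ℚᵘ.≃-Reasoning

  ι-homo‿- : ∀ a → ι (ℤ.- a) ≡ - ι a
  ι-homo‿- a = toℚᵘ-injective (begin
    toℚᵘ (ι (ℤ.- a))  ≈⟨ toℚᵘ-ι (ℤ.- a) ⟩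
    mkℚᵘ (ℤ.- a) 0    ≈⟨ ℚᵘ.-‿cong (toℚᵘ-ι a) ⟨
    ℚᵘ.- toℚᵘ (ι a)   ≈⟨ toℚᵘ-homo‿- (ι a) ⟨
    toℚᵘ (- ι a)      ∎)
    where open ℚᵘ.≃-Reasoning

  -- ev is given by its two defining equations so that both evalZ and evalXY are instances.
  module Horner {A : Set} (0# : A) (_⊕_ _⊗_ : A → A → A) (⊖_ : A → A)
                (φ : A → ℚ) (φ-⊕ : ∀ a b → φ (a ⊕ b) ≡ φ a + φ b) (φ-⊖ : ∀ a → φ (⊖ a) ≡ - φ a)
                (t : ℚ) (ev : List A → ℚ) (ev-[] : ev [] ≡ 0ℚ) (ev-∷ : ∀ a p → ev (a ∷ p) ≡ φ a + t * ev p)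
                where
    open PolyOps 0# _⊕_ _⊗_ ⊖_
    open ≡-Reasoning

    ev-add : ∀ p q → ev (add p q) ≡ ev p + ev q
    ev-add []      q       = trans (identity (ev q)) (cong (_+ ev q) (sym ev-[]))
      where
      identity : ∀ x → x ≡ 0ℚ + x
      identity = solve-∀ ℚ-ring
    ev-add (a ∷ p) []      = trans (identity (ev (a ∷ p))) (cong (ev (a ∷ p) +_) (sym ev-[]))
      where
      identity : ∀ x → x ≡ x + 0ℚ
      identity = solve-∀ ℚ-ring
    ev-add (a ∷ p) (b ∷ q) = begin
      ev ((a ⊕ b) ∷ add p q)                 ≡⟨ ev-∷ (a ⊕ b) (add p q) ⟩
      φ (a ⊕ b) + t * ev (add p q)           ≡⟨ cong₂ (λ x y → x + t * y) (φ-⊕ a b) (ev-add p q) ⟩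
      (φ a + φ b) + t * (ev p + ev q)        ≡⟨ identity t (φ a) (φ b) (ev p) (ev q) ⟩
      (φ a + t * ev p) + (φ b + t * ev q)    ≡⟨ cong₂ _+_ (ev-∷ a p) (ev-∷ b q) ⟨
      ev (a ∷ p) + ev (b ∷ q)                ∎
      where
      identity : ∀ t x y u v → (x + y) + t * (u + v) ≡ (x + t * u) + (y + t * v)
      identity = solve-∀ ℚ-ring

    ev-neg : ∀ p → ev (neg p) ≡ - ev p
    ev-neg []      = trans ev-[] (cong -_ (sym ev-[]))
    ev-neg (a ∷ p) = begin
      ev (⊖ a ∷ neg p)          ≡⟨ ev-∷ (⊖ a) (neg p) ⟩
      φ (⊖ a) + t * ev (neg p)  ≡⟨ cong₂ (λ x y → x + t * y) (φ-⊖ a) (ev-neg p) ⟩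
      - φ a + t * - ev p        ≡⟨ identity t (φ a) (ev p) ⟩
      - (φ a + t * ev p)        ≡⟨ cong -_ (ev-∷ a p) ⟨
      - ev (a ∷ p)              ∎
      where
      identity : ∀ t x u → - x + t * - u ≡ - (x + t * u)
      identity = solve-∀ ℚ-ring

    ev-scale : (∀ a b → φ (a ⊗ b) ≡ φ a * φ b) → ∀ c p → ev (scale c p) ≡ φ c * ev p
    ev-scale φ-⊗ c []      = trans ev-[] (trans (identity (φ c)) (cong (φ c *_) (sym ev-[])))
      where
      identity : ∀ x → 0ℚ ≡ x * 0ℚ
      identity = solve-∀ ℚ-ring
    ev-scale φ-⊗ c (a ∷ p) = begin
      ev (c ⊗ a ∷ scale c p)              ≡⟨ ev-∷ (c ⊗ a) (scale c p) ⟩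
      φ (c ⊗ a) + t * ev (scale c p)      ≡⟨ cong₂ (λ x y → x + t * y) (φ-⊗ c a) (ev-scale φ-⊗ c p) ⟩
      φ c * φ a + t * (φ c * ev p)        ≡⟨ identity t (φ c) (φ a) (ev p) ⟩
      φ c * (φ a + t * ev p)              ≡⟨ cong (φ c *_) (ev-∷ a p) ⟨
      φ c * ev (a ∷ p)                    ∎
      where
      identity : ∀ t x y u → x * y + t * (x * u) ≡ x * (y + t * u)
      identity = solve-∀ ℚ-ring

  module HornerZ (t : ℚ) =
    Horner 0ℤ ℤ._+_ ℤ._*_ ℤ.-_ ι ι-homo-+ ι-homo‿- t (λ p → evalZ p t) refl (λ _ _ → refl)

  module HornerXY (s t : ℚ) =
    Horner [] PZ.add PZ.mul PZ.neg (λ a → evalZ a t) (HornerZ.ev-add t) (HornerZ.ev-neg t)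
           s (λ P → evalXY P s t) refl (λ _ _ → refl)

  evalXY-outer : ∀ u v s t → evalXY (outer u v) s t ≡ evalZ u s * evalZ v t
  evalXY-outer []      v s t = identity (evalZ v t)
    where
    identity : ∀ x → 0ℚ ≡ 0ℚ * x
    identity = solve-∀ ℚ-ring
  evalXY-outer (a ∷ u) v s t = begin
    evalZ (PZ.scale a v) t + s * evalXY (outer u v) s t
      ≡⟨ cong₂ (λ x y → x + s * y) (HornerZ.ev-scale t ι-homo-* a v) (evalXY-outer u v s t) ⟩
    ι a * evalZ v t + s * (evalZ u s * evalZ v t)         ≡⟨ identity s (ι a) (evalZ u s) (evalZ v t) ⟩
    (ι a + s * evalZ u s) * evalZ v t                     ∎
    where
    open ≡-Reasoning
    identity : ∀ s x y z → x * z + s * (y * z) ≡ (x + s * y) * z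
    identity = solve-∀ ℚ-ring

  x+[e-1]*y≡x : ∀ {e} → e ≡ 1ℚ → ∀ x y → x + (e - 1ℚ) * y ≡ x
  x+[e-1]*y≡x refl = identity
    where
    identity : ∀ x y → x + (1ℚ - 1ℚ) * y ≡ x
    identity = solve-∀ ℚ-ring

  module Lucas (s : ℚ) (u : ℕ → ℚ) (u-0 : u 0 ≡ 0ℚ) (u-1 : u 1 ≡ 1ℚ)
               (u-rec : ∀ k → u (suc (suc k)) ≡ s * u (suc k) - u k) where
    open ≡-Reasoning

    u-suc : ∀ δ δ' → δ * δ' ≡ 1ℚ → s ≡ δ + δ' → ∀ k → u (suc k) ≡ δ * u k + δ' ^ℚ k
    u-suc δ δ' _ _ zero = begin
      u 1             ≡⟨ u-1 ⟩
      1ℚ              ≡⟨ identity δ ⟩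
      δ * 0ℚ + 1ℚ     ≡⟨ cong (λ x → δ * x + 1ℚ) u-0 ⟨
      δ * u 0 + 1ℚ    ∎
      where
      identity : ∀ δ → 1ℚ ≡ δ * 0ℚ + 1ℚ
      identity = solve-∀ ℚ-ring
    u-suc δ δ' δδ'≡1 s≡δ+δ' (suc k) = begin
      u (suc (suc k))                                                  ≡⟨ u-rec k ⟩
      s * u (suc k) - u k                                              ≡⟨ cong₂ (λ x y → x * y - u k) s≡δ+δ' IH ⟩
      (δ + δ') * (δ * u k + δ' ^ℚ k) - u k                             ≡⟨ identity δ δ' (u k) (δ' ^ℚ k) ⟩
      δ * (δ * u k + δ' ^ℚ k) + δ' * δ' ^ℚ k + (δ * δ' - 1ℚ) * u k    ≡⟨ x+[e-1]*y≡x δδ'≡1 _ (u k) ⟩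
      δ * (δ * u k + δ' ^ℚ k) + δ' * δ' ^ℚ k                           ≡⟨ cong (λ x → δ * x + δ' * δ' ^ℚ k) IH ⟨
      δ * u (suc k) + δ' ^ℚ suc k                                      ∎
      where
      IH : u (suc k) ≡ δ * u k + δ' ^ℚ k
      IH = u-suc δ δ' δδ'≡1 s≡δ+δ' k
      identity : ∀ δ δ' x y → (δ + δ') * (δ * x + y) - x ≡ δ * (δ * x + y) + δ' * y + (δ * δ' - 1ℚ) * x
      identity = solve-∀ ℚ-ring

    u-neighbours : ∀ δ δ' → δ * δ' ≡ 1ℚ → s ≡ δ + δ' → ∀ m →
        u (suc (suc m)) ≡ δ * u (suc m) + δ' ^ℚ suc m
      × u m ≡ δ' * u (suc m) - δ' ^ℚ suc m
      × δ ^ℚ suc m ≡ δ' ^ℚ suc m + (δ - δ') * u (suc m)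
    u-neighbours δ δ' δδ'≡1 s≡δ+δ' m = u-suc δ δ' δδ'≡1 s≡δ+δ' (suc m) , previous , power
      where
      previous : u m ≡ δ' * u (suc m) - δ' ^ℚ suc m
      previous = begin
        u m                                        ≡⟨ x+[e-1]*y≡x δδ'≡1 (u m) (u m) ⟨
        u m + (δ * δ' - 1ℚ) * u m                  ≡⟨ identity δ δ' (u m) (δ' ^ℚ m) ⟩
        δ' * (δ * u m + δ' ^ℚ m) - δ' ^ℚ suc m     ≡⟨ cong (λ x → δ' * x - δ' ^ℚ suc m) (u-suc δ δ' δδ'≡1 s≡δ+δ' m) ⟨
        δ' * u (suc m) - δ' ^ℚ suc m               ∎
        where
        identity : ∀ δ δ' x y → x + (δ * δ' - 1ℚ) * x ≡ δ' * (δ * x + y) - δ' * y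
        identity = solve-∀ ℚ-ring
      power : δ ^ℚ suc m ≡ δ' ^ℚ suc m + (δ - δ') * u (suc m)
      power = begin
        δ ^ℚ suc m                                       ≡⟨ identity₁ (δ' * u (suc m)) (δ ^ℚ suc m) ⟩
        (δ' * u (suc m) + δ ^ℚ suc m) - δ' * u (suc m)   ≡⟨ cong (_- δ' * u (suc m)) two-ways ⟩
        (δ * u (suc m) + δ' ^ℚ suc m) - δ' * u (suc m)   ≡⟨ identity₂ δ δ' (u (suc m)) (δ' ^ℚ suc m) ⟩
        δ' ^ℚ suc m + (δ - δ') * u (suc m)               ∎
        where
        two-ways : δ' * u (suc m) + δ ^ℚ suc m ≡ δ * u (suc m) + δ' ^ℚ suc m
        two-ways = trans (sym (u-suc δ' δ (trans (*-comm δ' δ) δδ'≡1) (trans s≡δ+δ' (+-comm δ δ')) (suc m)))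
                         (u-suc δ δ' δδ'≡1 s≡δ+δ' (suc m))
        identity₁ : ∀ x y → y ≡ (x + y) - x
        identity₁ = solve-∀ ℚ-ring
        identity₂ : ∀ δ δ' x y → (δ * x + y) - δ' * x ≡ y + (δ - δ') * x
        identity₂ = solve-∀ ℚ-ring

  evalZ-S-1 : ∀ s → evalZ (S 1) s ≡ 1ℚ
  evalZ-S-1 = identity
    where
    identity : ∀ s → 1ℚ + s * 0ℚ ≡ 1ℚ
    identity = solve-∀ ℚ-ring

  evalZ-S-rec : ∀ s k → evalZ (S (suc (suc k))) s ≡ s * evalZ (S (suc k)) s - evalZ (S k) s
  evalZ-S-rec s k = begin
    evalZ (PZ.sub (0ℤ ∷ S (suc k)) (S k)) s                         ≡⟨ HornerZ.ev-add s (0ℤ ∷ S (suc k)) (PZ.neg (S k)) ⟩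
    evalZ (0ℤ ∷ S (suc k)) s + evalZ (PZ.neg (S k)) s               ≡⟨ cong (evalZ (0ℤ ∷ S (suc k)) s +_) (HornerZ.ev-neg s (S k)) ⟩
    0ℚ + s * evalZ (S (suc k)) s + - evalZ (S k) s                  ≡⟨ identity s (evalZ (S (suc k)) s) (evalZ (S k) s) ⟩
    s * evalZ (S (suc k)) s - evalZ (S k) s                         ∎
    where
    open ≡-Reasoning
    identity : ∀ s x y → 0ℚ + s * x + - y ≡ s * x - y
    identity = solve-∀ ℚ-ring

  module LucasS (s : ℚ) = Lucas s (λ k → evalZ (S k) s) refl (evalZ-S-1 s) (evalZ-S-rec s)

  -- The η-hypotheses are those of u-neighbours for the root pair (η', η).
  trace-identity : ∀ δ δ' η η' A B P E {X₊ X₋ Dᵐ Y₊ Y₋ Q : ℚ} →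
    X₊ ≡ δ * A + P → X₋ ≡ δ' * A - P → Dᵐ ≡ P + (δ - δ') * A →
    Y₊ ≡ η' * B + E → Y₋ ≡ η * B - E → Q ≡ E + (η' - η) * B →
    - (X₊ * Y₋ + X₋ * Y₊) + A * B * (δ * η + δ' * η') ≡ Dᵐ * E + P * Q
  trace-identity δ δ' η η' A B P E refl refl refl refl refl refl = identity δ δ' η η' A B P E
    where
    identity : ∀ δ δ' η η' A B P E →
      - ((δ * A + P) * (η * B - E) + (δ' * A - P) * (η' * B + E)) + A * B * (δ * η + δ' * η')
        ≡ (P + (δ - δ') * A) * E + P * (E + (η' - η) * B)
    identity = solve-∀ ℚ-ring

  evalXY-p-part : ∀ m n s t →
    evalXY (p-part m n) s t ≡ - (evalZ (S (suc m)) s * evalZ (S (pred n)) t + evalZ (S (pred m)) s * evalZ (S (suc n)) t)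
  evalXY-p-part m n s t =
    trans (HornerXY.ev-neg s t (P2.add (outer (S (suc m)) (S (pred n))) (outer (S (pred m)) (S (suc n)))))
          (cong -_ (trans (HornerXY.ev-add s t (outer (S (suc m)) (S (pred n))) (outer (S (pred m)) (S (suc n))))
                          (cong₂ _+_ (evalXY-outer (S (suc m)) (S (pred n)) s t) (evalXY-outer (S (pred m)) (S (suc n)) s t))))

  p+qz-trace : ∀ {m n} → 1 ≤ m → 1 ≤ n → InR₂ (p-part m n) (q-part m n) m n
  p+qz-trace {suc m} {suc n} (s≤s z≤n) (s≤s z≤n) δ η =
    let x₊ , x₋ , δᵐ = LucasS.u-neighbours s δ δ' (*-inverseʳ δ) refl m
        y₊ , y₋ , η'ⁿ = LucasS.u-neighbours t η' η (trans (*-comm η' η) (*-inverseʳ η)) (+-comm η η') n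
    in trans (cong₂ (λ x y → x + y * (δ * η + δ' * η'))
                    (evalXY-p-part (suc m) (suc n) s t) (evalXY-outer (S (suc m)) (S (suc n)) s t))
             (trace-identity δ δ' η η' (evalZ (S (suc m)) s) (evalZ (S (suc n)) t) (δ' ^ℚ suc m) (η ^ℚ suc n)
                             x₊ x₋ δᵐ y₊ y₋ η'ⁿ)
    where
    δ' η' s t : ℚ
    δ' = 1/ δ
    η' = 1/ η
    s = δ + δ'
    t = η + η'

module Coefficients where
  open import Defs
  open Chebyshev
  open import Data.Nat as ℕ using (ℕ; zero; suc; pred; z≤n; s≤s)
  open import Data.Nat.Properties using (n≤1+n; m≤n⇒m≤1+n; <⇒≤; m+n≤o⇒n≤o; m≤n+m; <-trans; +-suc)
  open import Data.Integer using (ℤ; 0ℤ; 1ℤ; -1ℤ; _+_; _*_; -_; _-_)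
  open import Data.Integer.Properties using (+-identityˡ; +-identityʳ; *-identityˡ; *-identityʳ; *-zeroʳ)
  open import Data.Sum as ⊎ using (_⊎_; inj₁)
  open import Data.Integer.Tactic.RingSolver using (solve-∀)
  open import Data.List using ([]; _∷_)
  open import Data.Product using (_×_; _,_)
  open import Function using (_∘_; const)
  open import Relation.Binary.PropositionalEquality

  module PolyCoeff {A : Set} (0# : A) (_⊕_ _⊗_ : A → A → A) (⊖_ : A → A) where
    open PolyOps 0# _⊕_ _⊗_ ⊖_

    coeff-add : (∀ b → 0# ⊕ b ≡ b) → (∀ a → a ⊕ 0# ≡ a) →
                ∀ p q k → coeff 0# (add p q) k ≡ coeff 0# p k ⊕ coeff 0# q k
    coeff-add idˡ idʳ []      q       k       = sym (idˡ (coeff 0# q k))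
    coeff-add idˡ idʳ (a ∷ p) []      k       = sym (idʳ (coeff 0# (a ∷ p) k))
    coeff-add idˡ idʳ (a ∷ p) (b ∷ q) zero    = refl
    coeff-add idˡ idʳ (a ∷ p) (b ∷ q) (suc k) = coeff-add idˡ idʳ p q k

    coeff-neg : ⊖ 0# ≡ 0# → ∀ p k → coeff 0# (neg p) k ≡ ⊖ coeff 0# p k
    coeff-neg ⊖0≡0 []      k       = sym ⊖0≡0
    coeff-neg ⊖0≡0 (a ∷ p) zero    = refl
    coeff-neg ⊖0≡0 (a ∷ p) (suc k) = coeff-neg ⊖0≡0 p k

  coeffs : PolyZ → ℕ → ℤ
  coeffs = coeff 0ℤ

  coeffs-add : ∀ p q → coeffs (PZ.add p q) ≗ λ j → coeffs p j + coeffs q j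
  coeffs-add = PolyCoeff.coeff-add 0ℤ _+_ _*_ -_ +-identityˡ +-identityʳ

  coeffs-neg : ∀ p → coeffs (PZ.neg p) ≗ λ j → - coeffs p j
  coeffs-neg = PolyCoeff.coeff-neg 0ℤ _+_ _*_ -_ refl

  coeffs-scale : ∀ c p → coeffs (PZ.scale c p) ≗ λ j → c * coeffs p j
  coeffs-scale c []      j       = sym (*-zeroʳ c)
  coeffs-scale c (a ∷ p) zero    = refl
  coeffs-scale c (a ∷ p) (suc j) = coeffs-scale c p j

  shift : (ℕ → ℤ) → ℕ → ℤ
  shift f zero    = 0ℤ
  shift f (suc j) = f j

  coeffs-∷0 : ∀ p → coeffs (0ℤ ∷ p) ≗ shift (coeffs p)
  coeffs-∷0 p zero    = refl
  coeffs-∷0 p (suc j) = refl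

  infixl 7 _⋆_
  _⋆_ : (ℕ → ℤ) → (ℕ → ℤ) → ℕ → ℤ
  (f ⋆ g) zero    = f 0 * g 0
  (f ⋆ g) (suc j) = f 0 * g (suc j) + ((f ∘ suc) ⋆ g) j

  ⋆-cong : ∀ {f f' g g'} → f ≗ f' → g ≗ g' → f ⋆ g ≗ f' ⋆ g'
  ⋆-cong f≗f' g≗g' zero    = cong₂ _*_ (f≗f' 0) (g≗g' 0)
  ⋆-cong f≗f' g≗g' (suc j) = cong₂ _+_ (cong₂ _*_ (f≗f' 0) (g≗g' (suc j))) (⋆-cong (f≗f' ∘ suc) g≗g' j)

  ⋆-zeroˡ : ∀ {f} g → f ≗ const 0ℤ → f ⋆ g ≗ const 0ℤ
  ⋆-zeroˡ g f≗0 zero    = cong (_* g 0) (f≗0 0)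
  ⋆-zeroˡ g f≗0 (suc j) = cong₂ (λ x y → x * g (suc j) + y) (f≗0 0) (⋆-zeroˡ g (f≗0 ∘ suc) j)

  ⋆-zeroʳ : ∀ f {g} → g ≗ const 0ℤ → f ⋆ g ≗ const 0ℤ
  ⋆-zeroʳ f g≗0 zero    = trans (cong (f 0 *_) (g≗0 0)) (*-zeroʳ (f 0))
  ⋆-zeroʳ f {g} g≗0 (suc j) = begin
    f 0 * g (suc j) + ((f ∘ suc) ⋆ g) j  ≡⟨ cong₂ (λ x y → f 0 * x + y) (g≗0 (suc j)) (⋆-zeroʳ (f ∘ suc) g≗0 j) ⟩
    f 0 * 0ℤ + 0ℤ                        ≡⟨ +-identityʳ (f 0 * 0ℤ) ⟩
    f 0 * 0ℤ                             ≡⟨ *-zeroʳ (f 0) ⟩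
    0ℤ                                   ∎
    where open ≡-Reasoning

  ⋆-identityˡ : ∀ g → coeffs (1ℤ ∷ []) ⋆ g ≗ g
  ⋆-identityˡ g zero    = *-identityˡ (g 0)
  ⋆-identityˡ g (suc j) = trans (cong (1ℤ * g (suc j) +_) (⋆-zeroˡ g (λ _ → refl) j))
                                (trans (+-identityʳ _) (*-identityˡ (g (suc j))))

  ⋆-identityʳ : ∀ f → f ⋆ coeffs (1ℤ ∷ []) ≗ f
  ⋆-identityʳ f zero    = *-identityʳ (f 0)
  ⋆-identityʳ f (suc j) = trans (cong₂ _+_ (*-zeroʳ (f 0)) (⋆-identityʳ (f ∘ suc) j)) (+-identityˡ (f (suc j)))

  ⋆-negˡ : ∀ f g → (λ i → - f i) ⋆ g ≗ λ j → - (f ⋆ g) j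
  ⋆-negˡ f g zero    = identity (f 0) (g 0)
    where
    identity : ∀ x y → - x * y ≡ - (x * y)
    identity = solve-∀
  ⋆-negˡ f g (suc j) = trans (cong (- f 0 * g (suc j) +_) (⋆-negˡ (f ∘ suc) g j))
                             (identity (f 0) (g (suc j)) (((f ∘ suc) ⋆ g) j))
    where
    identity : ∀ x y z → - x * y + - z ≡ - (x * y + z)
    identity = solve-∀

  ⋆-negʳ : ∀ f g → f ⋆ (λ i → - g i) ≗ λ j → - (f ⋆ g) j
  ⋆-negʳ f g zero    = identity (f 0) (g 0)
    where
    identity : ∀ x y → x * - y ≡ - (x * y)
    identity = solve-∀
  ⋆-negʳ f g (suc j) = trans (cong (f 0 * - g (suc j) +_) (⋆-negʳ (f ∘ suc) g j))
                             (identity (f 0) (g (suc j)) (((f ∘ suc) ⋆ g) j))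
    where
    identity : ∀ x y z → x * - y + - z ≡ - (x * y + z)
    identity = solve-∀

  ⋆-subˡ : ∀ f f' g → (λ i → f i - f' i) ⋆ g ≗ λ j → (f ⋆ g) j - (f' ⋆ g) j
  ⋆-subˡ f f' g zero    = identity (f 0) (f' 0) (g 0)
    where
    identity : ∀ x x' y → (x - x') * y ≡ x * y - x' * y
    identity = solve-∀
  ⋆-subˡ f f' g (suc j) = trans (cong ((f 0 - f' 0) * g (suc j) +_) (⋆-subˡ (f ∘ suc) (f' ∘ suc) g j))
                                (identity (f 0) (f' 0) (g (suc j)) (((f ∘ suc) ⋆ g) j) (((f' ∘ suc) ⋆ g) j))
    where
    identity : ∀ x x' y z z' → (x - x') * y + (z - z') ≡ (x * y + z) - (x' * y + z')
    identity = solve-∀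

  ⋆-subʳ : ∀ f g g' → f ⋆ (λ i → g i - g' i) ≗ λ j → (f ⋆ g) j - (f ⋆ g') j
  ⋆-subʳ f g g' zero    = identity (f 0) (g 0) (g' 0)
    where
    identity : ∀ x y y' → x * (y - y') ≡ x * y - x * y'
    identity = solve-∀
  ⋆-subʳ f g g' (suc j) = trans (cong (f 0 * (g (suc j) - g' (suc j)) +_) (⋆-subʳ (f ∘ suc) g g' j))
                                (identity (f 0) (g (suc j)) (g' (suc j)) (((f ∘ suc) ⋆ g) j) (((f ∘ suc) ⋆ g') j))
    where
    identity : ∀ x y y' z z' → x * (y - y') + (z - z') ≡ (x * y + z) - (x * y' + z')
    identity = solve-∀

  shift-⋆ : ∀ f g j → (shift f ⋆ g) (suc j) ≡ (f ⋆ g) j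
  shift-⋆ f g j = +-identityˡ ((f ⋆ g) j)

  ⋆-shift : ∀ f g j → (f ⋆ shift g) (suc j) ≡ (f ⋆ g) j
  ⋆-shift f g zero    = trans (cong (f 0 * g 0 +_) (*-zeroʳ (f 1))) (+-identityʳ (f 0 * g 0))
  ⋆-shift f g (suc j) = cong (f 0 * g (suc j) +_) (⋆-shift (f ∘ suc) g j)

  shift-⋆-shift : ∀ f g → shift f ⋆ g ≗ f ⋆ shift g
  shift-⋆-shift f g zero    = sym (*-zeroʳ (f 0))
  shift-⋆-shift f g (suc j) = trans (shift-⋆ f g j) (sym (⋆-shift f g j))

  coeffs-mul : ∀ p q → coeffs (PZ.mul p q) ≗ coeffs p ⋆ coeffs q
  coeffs-mul []      q j       = sym (⋆-zeroˡ (coeffs q) (λ _ → refl) j)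
  coeffs-mul (a ∷ p) q zero    = trans (coeffs-add (PZ.scale a q) (0ℤ ∷ PZ.mul p q) 0)
                                       (trans (+-identityʳ _) (coeffs-scale a q 0))
  coeffs-mul (a ∷ p) q (suc j) = trans (coeffs-add (PZ.scale a q) (0ℤ ∷ PZ.mul p q) (suc j))
                                       (cong₂ _+_ (coeffs-scale a q (suc j)) (coeffs-mul p q j))

  s : ℕ → ℕ → ℤ
  s k = coeffs (S k)

  s-rec : ∀ k → s (suc (suc k)) ≗ λ j → shift (s (suc k)) j - s k j
  s-rec k j = trans (coeffs-add (0ℤ ∷ S (suc k)) (PZ.neg (S k)) j)
                    (cong₂ _+_ (coeffs-∷0 (S (suc k)) j) (coeffs-neg (S k) j))

  s-vanishes : ∀ k j → k ℕ.≤ j → s k j ≡ 0ℤ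
  s-vanishes zero          j       _         = refl
  s-vanishes (suc zero)    (suc j) _         = refl
  s-vanishes (suc (suc k)) (suc j) (s≤s k<j) rewrite s-rec k (suc j) | s-vanishes (suc k) j k<j
                                                    | s-vanishes k (suc j) (m≤n⇒m≤1+n (<⇒≤ k<j)) = refl

  s-leading : ∀ k → s (suc k) k ≡ 1ℤ
  s-leading zero    = refl
  s-leading (suc k) rewrite s-rec k (suc k) | s-leading k | s-vanishes k (suc k) (n≤1+n k) = refl

  casoratian : ℕ → ℕ → ℕ → ℤ
  casoratian i j k = (s (suc i) ⋆ s j) k - (s i ⋆ s (suc j)) k

  casoratian-suc : ∀ i j → casoratian (suc i) (suc j) ≗ casoratian i j
  casoratian-suc i j k = begin
    (s (suc (suc i)) ⋆ s (suc j)) k - (s (suc i) ⋆ s (suc (suc j))) k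
      ≡⟨ cong₂ _-_ (trans (⋆-cong (s-rec i) (λ _ → refl) k) (⋆-subˡ (shift (s (suc i))) (s i) (s (suc j)) k))
                   (trans (⋆-cong (λ _ → refl) (s-rec j) k) (⋆-subʳ (s (suc i)) (shift (s (suc j))) (s j) k)) ⟩
    ((shift (s (suc i)) ⋆ s (suc j)) k - (s i ⋆ s (suc j)) k) - ((s (suc i) ⋆ shift (s (suc j))) k - (s (suc i) ⋆ s j) k)
      ≡⟨ cong (λ x → (x - (s i ⋆ s (suc j)) k) - ((s (suc i) ⋆ shift (s (suc j))) k - (s (suc i) ⋆ s j) k))
              (shift-⋆-shift (s (suc i)) (s (suc j)) k) ⟩
    ((s (suc i) ⋆ shift (s (suc j))) k - (s i ⋆ s (suc j)) k) - ((s (suc i) ⋆ shift (s (suc j))) k - (s (suc i) ⋆ s j) k)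
      ≡⟨ identity ((s (suc i) ⋆ shift (s (suc j))) k) ((s i ⋆ s (suc j)) k) ((s (suc i) ⋆ s j) k) ⟩
    (s (suc i) ⋆ s j) k - (s i ⋆ s (suc j)) k
      ∎
    where
    open ≡-Reasoning
    identity : ∀ x y z → (x - y) - (x - z) ≡ z - y
    identity = solve-∀

  casoratian-zeroˡ : ∀ j → casoratian 0 j ≗ s j
  casoratian-zeroˡ j k = trans (cong₂ _-_ (⋆-identityˡ (s j) k) (⋆-zeroˡ (s (suc j)) (λ _ → refl) k)) (+-identityʳ (s j k))

  casoratian-zeroʳ : ∀ i → casoratian (suc i) 0 ≗ λ k → - s (suc i) k
  casoratian-zeroʳ i k = trans (cong₂ _-_ (⋆-zeroʳ (s (suc (suc i))) (λ _ → refl) k) (⋆-identityʳ (s (suc i)) k))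
                               (+-identityˡ (- s (suc i) k))

  casoratian-≤ : ∀ {i j} → i ℕ.≤ j → casoratian i j ≗ s (j ℕ.∸ i)
  casoratian-≤ {zero}  {j}     _         = casoratian-zeroˡ j
  casoratian-≤ {suc i} {suc j} (s≤s i≤j) k = trans (casoratian-suc i j k) (casoratian-≤ i≤j k)

  casoratian-> : ∀ {i j} → j ℕ.< i → casoratian i j ≗ λ k → - s (i ℕ.∸ j) k
  casoratian-> {suc i} {zero}  _         = casoratian-zeroʳ i
  casoratian-> {suc i} {suc j} (s≤s j<i) k = trans (casoratian-suc i j k) (casoratian-> j<i k)

  coeff2-add : ∀ P Q k → coeff2 (P2.add P Q) k ≗ λ j → coeff2 P k j + coeff2 Q k j
  coeff2-add P Q k j = trans (cong (λ r → coeffs r j) (PolyCoeff.coeff-add [] PZ.add PZ.mul PZ.neg (λ _ → refl) add-[] P Q k))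
                             (coeffs-add (coeff [] P k) (coeff [] Q k) j)
    where
    add-[] : ∀ p → PZ.add p [] ≡ p
    add-[] []      = refl
    add-[] (a ∷ p) = refl

  coeff2-neg : ∀ P k → coeff2 (P2.neg P) k ≗ λ j → - coeff2 P k j
  coeff2-neg P k j = trans (cong (λ r → coeffs r j) (PolyCoeff.coeff-neg [] PZ.add PZ.mul PZ.neg refl P k))
                           (coeffs-neg (coeff [] P k) j)

  coeff2-sub : ∀ P Q k → coeff2 (P2.sub P Q) k ≗ λ j → coeff2 P k j - coeff2 Q k j
  coeff2-sub P Q k j = trans (coeff2-add P (P2.neg Q) k j) (cong (coeff2 P k j +_) (coeff2-neg Q k j))

  coeff2-scale : ∀ A Q k → coeff2 (P2.scale A Q) k ≗ coeffs A ⋆ coeff2 Q k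
  coeff2-scale A []      k       j = sym (⋆-zeroʳ (coeffs A) (λ _ → refl) j)
  coeff2-scale A (B ∷ Q) zero    j = coeffs-mul A B j
  coeff2-scale A (B ∷ Q) (suc k) j = coeff2-scale A Q k j

  coeff2-outer : ∀ u v k → coeff2 (outer u v) k ≗ λ j → coeffs u k * coeffs v j
  coeff2-outer []      v k       j = refl
  coeff2-outer (a ∷ u) v zero    j = coeffs-scale a v j
  coeff2-outer (a ∷ u) v (suc k) j = coeff2-outer u v k j

  coeff2-mul-∷ : ∀ A P Q k → coeff2 (P2.mul (A ∷ P) Q) k ≗ λ j → (coeffs A ⋆ coeff2 Q k) j + coeff2 ([] ∷ P2.mul P Q) k j
  coeff2-mul-∷ A P Q k j = trans (coeff2-add (P2.scale A Q) ([] ∷ P2.mul P Q) k j)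
                                 (cong (_+ coeff2 ([] ∷ P2.mul P Q) k j) (coeff2-scale A Q k j))

  Vanishes : Poly2 → Set
  Vanishes P = ∀ k → coeff2 P k ≗ const 0ℤ

  ∷-vanishes : ∀ {R} → Vanishes R → Vanishes ([] ∷ R)
  ∷-vanishes R≗0 zero    j = refl
  ∷-vanishes R≗0 (suc k) j = R≗0 k j

  mul-vanishesˡ : ∀ P Q → Vanishes P → Vanishes (P2.mul P Q)
  mul-vanishesˡ []      Q P≗0 k j = refl
  mul-vanishesˡ (A ∷ P) Q P≗0 k j =
    trans (coeff2-mul-∷ A P Q k j)
          (cong₂ _+_ (⋆-zeroˡ (coeff2 Q k) (P≗0 0) j) (∷-vanishes (mul-vanishesˡ P Q (P≗0 ∘ suc)) k j))

  XDegree≤ : Poly2 → ℕ → Set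
  XDegree≤ P m = ∀ k → m ℕ.< k → coeff2 P k ≗ const 0ℤ

  record XLeading (P : Poly2) (m : ℕ) (f : ℕ → ℤ) : Set where
    constructor _,_
    field
      x-degree : XDegree≤ P m
      x-top    : coeff2 P m ≗ f

  XLeading-cong : ∀ {P m f g} → f ≗ g → XLeading P m f → XLeading P m g
  XLeading-cong f≗g (deg , top) = deg , λ j → trans (top j) (f≗g j)

  XLeading-sub : ∀ {P Q m f g} → XLeading P m f → XLeading Q m g → XLeading (P2.sub P Q) m (λ j → f j - g j)
  XLeading-sub {P} {Q} {m} (deg-P , top-P) (deg-Q , top-Q) =
    (λ k m<k j → trans (coeff2-sub P Q k j) (cong₂ _-_ (deg-P k m<k j) (deg-Q k m<k j))) ,
    (λ j → trans (coeff2-sub P Q m j) (cong₂ _-_ (top-P j) (top-Q j)))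

  XLeading-sub-lower : ∀ {P m f} → XLeading P m f → ∀ Q {n} → XDegree≤ Q n → n ℕ.< m → XLeading (P2.sub P Q) m f
  XLeading-sub-lower {P} {m} {f} (deg-P , top-P) Q deg-Q n<m =
    (λ k m<k j → trans (coeff2-sub P Q k j) (cong₂ _-_ (deg-P k m<k j) (deg-Q k (<-trans n<m m<k) j))) ,
    (λ j → trans (coeff2-sub P Q m j) (trans (cong₂ _-_ (top-P j) (deg-Q m n<m j)) (+-identityʳ (f j))))

  XLeading-mul : ∀ P {Q m n f g} → XLeading P m f → XLeading Q n g → XLeading (P2.mul P Q) (m ℕ.+ n) (f ⋆ g)
  XLeading-mul []      {g = g} (_ , top-P) _ = (λ _ _ _ → refl) , λ j → sym (⋆-zeroˡ g (sym ∘ top-P) j)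
  XLeading-mul (A ∷ P) {Q} {zero} {n} {f} {g} (deg-P , top-P) (deg-Q , top-Q) = deg , top
    where
    xPQ≗0 : Vanishes ([] ∷ P2.mul P Q)
    xPQ≗0 = ∷-vanishes (mul-vanishesˡ P Q (λ k → deg-P (suc k) (s≤s z≤n)))
    deg : XDegree≤ (P2.mul (A ∷ P) Q) n
    deg k n<k j = trans (coeff2-mul-∷ A P Q k j) (cong₂ _+_ (⋆-zeroʳ (coeffs A) (deg-Q k n<k) j) (xPQ≗0 k j))
    top : coeff2 (P2.mul (A ∷ P) Q) n ≗ f ⋆ g
    top j = trans (coeff2-mul-∷ A P Q n j) (trans (cong₂ _+_ (⋆-cong top-P top-Q j) (xPQ≗0 n j)) (+-identityʳ _))
  XLeading-mul (A ∷ P) {Q} {suc m} {n} {f} {g} (deg-P , top-P) (deg-Q , top-Q) = deg , top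
    where
    PQ : XLeading (P2.mul P Q) (m ℕ.+ n) (f ⋆ g)
    PQ = XLeading-mul P ((λ k m<k → deg-P (suc k) (s≤s m<k)) , top-P) (deg-Q , top-Q)
    deg : XDegree≤ (P2.mul (A ∷ P) Q) (suc m ℕ.+ n)
    deg (suc k) (s≤s m+n<k) j =
      trans (coeff2-mul-∷ A P Q (suc k) j)
            (cong₂ _+_ (⋆-zeroʳ (coeffs A) (deg-Q (suc k) (s≤s (m+n≤o⇒n≤o m (<⇒≤ m+n<k)))) j)
                       (XLeading.x-degree PQ k m+n<k j))
    top : coeff2 (P2.mul (A ∷ P) Q) (suc m ℕ.+ n) ≗ f ⋆ g
    top j = trans (coeff2-mul-∷ A P Q (suc (m ℕ.+ n)) j)
                  (trans (cong₂ _+_ (⋆-zeroʳ (coeffs A) (deg-Q (suc (m ℕ.+ n)) (s≤s (m≤n+m n m))) j) (XLeading.x-top PQ j))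
                         (+-identityˡ _))

  X-degree : XDegree≤ X 1
  X-degree (suc zero)    (s≤s ())
  X-degree (suc (suc k)) _        j = refl

  Y-degree : XDegree≤ Y 0
  Y-degree (suc k) _ j = refl

  q-part-leading : ∀ m n → XLeading (q-part (suc m) n) m (s n)
  q-part-leading m n = deg , top
    where
    deg : XDegree≤ (q-part (suc m) n) m
    deg k m<k j rewrite coeff2-outer (S (suc m)) (S n) k j | s-vanishes (suc m) k m<k = refl
    top : coeff2 (q-part (suc m) n) m ≗ s n
    top j rewrite coeff2-outer (S (suc m)) (S n) m j | s-leading m = *-identityˡ (s n j)

  coeff2-p-part : ∀ m n k → coeff2 (p-part m n) k ≗ λ j → - (s (suc m) k * s (pred n) j + s (pred m) k * s (suc n) j)
  coeff2-p-part m n k j =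
    trans (coeff2-neg (P2.add (outer (S (suc m)) (S (pred n))) (outer (S (pred m)) (S (suc n)))) k j)
          (cong -_ (trans (coeff2-add (outer (S (suc m)) (S (pred n))) (outer (S (pred m)) (S (suc n))) k j)
                          (cong₂ _+_ (coeff2-outer (S (suc m)) (S (pred n)) k j) (coeff2-outer (S (pred m)) (S (suc n)) k j))))

  p-part-leading : ∀ m n → XLeading (p-part (suc m) n) (suc m) (λ j → - s (pred n) j)
  p-part-leading m n = deg , top
    where
    deg : XDegree≤ (p-part (suc m) n) (suc m)
    deg k m+1<k j rewrite coeff2-p-part (suc m) n k j | s-vanishes (suc (suc m)) k m+1<k
                        | s-vanishes m k (m+n≤o⇒n≤o 2 m+1<k) = refl
    top : coeff2 (p-part (suc m) n) (suc m) ≗ λ j → - s (pred n) j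
    top j rewrite coeff2-p-part (suc m) n (suc m) j | s-leading (suc m) | s-vanishes m (suc m) (n≤1+n m) =
      cong -_ (trans (+-identityʳ (1ℤ * s (pred n) j)) (*-identityˡ (s (pred n) j)))

  det-leading : ∀ {a b c d} → 2 ℕ.≤ a → 1 ℕ.≤ b → 1 ℕ.≤ c → 1 ℕ.≤ d →
                XLeading (det a b c d) (a ℕ.+ b ℕ.∸ 1) (casoratian (pred c) (pred d))
  det-leading {suc (suc a)} {suc b} {suc c} {suc d} (s≤s (s≤s z≤n)) (s≤s z≤n) (s≤s z≤n) (s≤s z≤n) =
    XLeading-cong top≗casoratian (XLeading-sub left right)
    where
    left : XLeading (P2.mul (P2.sub (p-part (suc (suc a)) (suc c)) X) (q-part (suc b) (suc d)))
                    (suc (a ℕ.+ suc b)) ((λ j → - s c j) ⋆ s (suc d))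
    left = subst (λ N → XLeading (P2.mul (P2.sub (p-part (suc (suc a)) (suc c)) X) (q-part (suc b) (suc d))) N
                                 ((λ j → - s c j) ⋆ s (suc d)))
                 (cong suc (sym (+-suc a b)))
                 (XLeading-mul _ (XLeading-sub-lower (p-part-leading (suc a) (suc c)) X X-degree (s≤s (s≤s z≤n)))
                                 (q-part-leading b (suc d)))
    right : XLeading (P2.mul (q-part (suc (suc a)) (suc c)) (P2.sub (p-part (suc b) (suc d)) Y))
                     (suc (a ℕ.+ suc b)) (s (suc c) ⋆ (λ j → - s d j))
    right = XLeading-mul _ (q-part-leading (suc a) (suc c))
                           (XLeading-sub-lower (p-part-leading b (suc d)) Y Y-degree (s≤s z≤n))
    top≗casoratian : (λ j → ((λ i → - s c i) ⋆ s (suc d)) j - (s (suc c) ⋆ (λ i → - s d i)) j) ≗ casoratian c d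
    top≗casoratian j = trans (cong₂ _-_ (⋆-negˡ (s c) (s (suc d)) j) (⋆-negʳ (s (suc c)) (s d) j))
                             (identity ((s c ⋆ s (suc d)) j) ((s (suc c) ⋆ s d) j))
      where
      identity : ∀ x y → - x - - y ≡ y - x
      identity = solve-∀

  MonicUpToSign : (ℕ → ℤ) → ℕ → Set
  MonicUpToSign f e = (f e ≡ 1ℤ ⊎ f e ≡ -1ℤ) × (∀ j → e ℕ.< j → f j ≡ 0ℤ)

  MonicUpToSign-cong : ∀ {f g e} → f ≗ g → MonicUpToSign f e → MonicUpToSign g e
  MonicUpToSign-cong {e = e} f≗g (top , above) =
    ⊎.map (trans (sym (f≗g e))) (trans (sym (f≗g e))) top , λ j e<j → trans (sym (f≗g j)) (above j e<j)

  MonicUpToSign-neg : ∀ {f e} → MonicUpToSign f e → MonicUpToSign (λ j → - f j) e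
  MonicUpToSign-neg (top , above) = ⊎.swap (⊎.map (cong (-_)) (cong (-_)) top) , λ j e<j → cong -_ (above j e<j)

  s-monic : ∀ {k} → 0 ℕ.< k → MonicUpToSign (s k) (k ℕ.∸ 1)
  s-monic {suc k} _ = inj₁ (s-leading k) , λ j k<j → s-vanishes (suc k) j k<j

module GoodMatrices where
  open import Defs
  open Coefficients using (casoratian; casoratian-≤; casoratian->; MonicUpToSign; MonicUpToSign-cong; MonicUpToSign-neg; s-monic)
  open import Data.Nat as ℕ using (suc; pred; s≤s)
  open import Data.Nat.Properties using (m*n≡1⇒n≡1; >⇒≢; <⇒≤; <-cmp; m<n⇒0<n∸m)
  open import Data.Integer using (+_; _*_; _-_; ∣_∣)
  open import Data.Integer.Properties using (abs-*; m-n≡m⊖n; ∣⊖∣-≤; ∣i-j∣≡∣j-i∣)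
  open import Data.Integer.Tactic.RingSolver using (solve-∀)
  open import Data.Product using (_×_; _,_)
  open import Data.Sum using ([_,_]′)
  open import Data.Empty using (⊥-elim)
  open import Relation.Binary.Definitions using (tri<; tri≈; tri>)
  open import Relation.Binary.PropositionalEquality

  ∣+m-+n∣≡n∸m : ∀ {m n} → m ℕ.≤ n → ∣ + m - + n ∣ ≡ n ℕ.∸ m
  ∣+m-+n∣≡n∸m {m} {n} m≤n = trans (cong ∣_∣ (m-n≡m⊖n m n)) (∣⊖∣-≤ m≤n)

  ∣+m-+n∣≡m∸n : ∀ {m n} → n ℕ.≤ m → ∣ + m - + n ∣ ≡ m ℕ.∸ n
  ∣+m-+n∣≡m∸n {m} {n} n≤m = trans (∣i-j∣≡∣j-i∣ (+ m) (+ n)) (∣+m-+n∣≡n∸m n≤m)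

  casoratian-monic : ∀ {c d} → 1 ℕ.≤ c → 1 ℕ.≤ d → c ≢ d →
                     1 ℕ.≤ ∣ + d - + c ∣ × MonicUpToSign (casoratian (pred c) (pred d)) (∣ + d - + c ∣ ℕ.∸ 1)
  casoratian-monic {suc i} {suc j} _ _ c≢d with <-cmp i j
  ... | tri< i<j _ _ rewrite ∣+m-+n∣≡m∸n (s≤s (<⇒≤ i<j)) =
    m<n⇒0<n∸m i<j , MonicUpToSign-cong (λ k → sym (casoratian-≤ (<⇒≤ i<j) k)) (s-monic (m<n⇒0<n∸m i<j))
  ... | tri≈ _ i≡j _ = ⊥-elim (c≢d (cong suc i≡j))
  ... | tri> _ _ j<i rewrite ∣+m-+n∣≡n∸m (s≤s (<⇒≤ j<i)) =
    m<n⇒0<n∸m j<i , MonicUpToSign-cong (λ k → sym (casoratian-> j<i k)) (MonicUpToSign-neg (s-monic (m<n⇒0<n∸m j<i)))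

  good⇒c≢d : ∀ {a b c d} → Good a b c d → c ≢ d
  good⇒c≢d {a} {b} {c} ((_ , _ , 2≤c , _) , det≡±1) refl = >⇒≢ 2≤c c≡1
    where
    open ≡-Reasoning
    identity : ∀ x y z → (x - y) * z ≡ x * z - y * z
    identity = solve-∀
    c≡1 : c ≡ 1
    c≡1 = m*n≡1⇒n≡1 ∣ + a - + b ∣ c (begin
      ∣ + a - + b ∣ ℕ.* c        ≡⟨ abs-* (+ a - + b) (+ c) ⟨
      ∣ (+ a - + b) * + c ∣      ≡⟨ cong ∣_∣ (identity (+ a) (+ b) (+ c)) ⟩
      ∣ + a * + c - + b * + c ∣  ≡⟨ [ cong ∣_∣ , cong ∣_∣ ]′ det≡±1 ⟩
      1                          ∎)

open import Defs
open import Data.Nat using (ℕ; _≤_; _<_; _∸_; _+_)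
open import Data.Integer using (ℤ; +_; -_; ∣_∣; _-_)
open import Data.List using (List)
open import Data.Product using (Σ; _×_; _,_)
open import Data.Sum using (_⊎_)
open import Relation.Binary.PropositionalEquality using (_≡_; _≢_)
open import Relation.Binary.PropositionalEquality using (refl; sym)
open import Data.List using ([])
open import Data.Nat.Properties using (<⇒≤)
open Chebyshev using (p-part; q-part; det)
open Evaluation using (p+qz-trace)
open Coefficients using (module XLeading; det-leading; MonicUpToSign-cong)
open GoodMatrices using (good⇒c≢d; casoratian-monic)

proposition3p5 :
  Σ (ℕ → ℕ → Poly2) λ p → Σ (ℕ → ℕ → Poly2) λ q →
    ((a b c d : ℕ) → Good a b c d →
      -- (1) g(x) = p_{a,c} + q_{a,c} z and g(y) = p_{b,d} + q_{b,d} z in R₂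
      (InR₂ (p a c) (q a c) a c × InR₂ (p b d) (q b d) b d)
      ×
      -- (2) D = x^{a+b-1} D₀ + O_x(x^{a+b-2})
      Σ PolyZ λ D₀ →
        let D = Det (p a c) (q a c) (p b d) (q b d)
            N = a + b ∸ 1
            e = ∣ + d - + c ∣ ∸ 1
        in ((j : ℕ) → coeff2 D N j ≡ coeff (+ 0) D₀ j)
           × ((k j : ℕ) → N < k → coeff2 D k j ≡ + 0)
           × 1 ≤ ∣ + d - + c ∣
           × ((coeff (+ 0) D₀ e ≡ + 1) ⊎ (coeff (+ 0) D₀ e ≡ - + 1))
           × ((j : ℕ) → e < j → coeff (+ 0) D₀ j ≡ + 0))
proposition3p5 = p-part , q-part , λ a b c d good →
  let (2≤a , 2≤b , 2≤c , 2≤d) , _ = good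
      D-leading = det-leading 2≤a (<⇒≤ 2≤b) (<⇒≤ 2≤c) (<⇒≤ 2≤d)
      1≤∣d-c∣ , D₀-monic = casoratian-monic (<⇒≤ 2≤c) (<⇒≤ 2≤d) (good⇒c≢d good)
  in (p+qz-trace (<⇒≤ 2≤a) (<⇒≤ 2≤c) , p+qz-trace (<⇒≤ 2≤b) (<⇒≤ 2≤d))
   , coeff [] (det a b c d) (a + b ∸ 1)
   , (λ _ → refl)
   , (λ k j N<k → XLeading.x-degree D-leading k N<k j)
   , 1≤∣d-c∣
   , MonicUpToSign-cong (λ j → sym (XLeading.x-top D-leading j)) D₀-monic
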